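{- Let $M=(E,G)$ be an $I_5$-free, $C_5$-free and triangle-free binary matroid, let $F$ be a flat of $G$ with $M|F\cong C_6$, and let $A$ be a coset of $F$ with $A\cap E\neq\varnothing$. Then $|A\cap E|\ge 4$. (Equivalently, $d_0\ge 4$, where $d_k$ is the minimum number of elements of $E$ in a non-empty coset of a flat on which $M$ induces $D^k(C_6)$, over all such $M$.)
   Context: A (simple binary) matroid is a pair $M=(E,G)$ where $G$ is a finite binary projective geometry identified with $\mathbb{F}_2^n\setminus\{0\}$ and $E\subseteq G$. A flat is a set $F\subseteq G$ with $\langle F\rangle:=F\cup\{0\}$ a subspace; $M|F=(E\cap F,F)$ is an induced restriction; isomorphism is an isomorphism of geometries carrying ground set to ground set. $M$ is $N$-free if no induced restriction is isomorphic to $N$. A triangle is a 2-dimensional flat; triangle-free means $E$ contains no triangle. $I_5=(B,G)$ with $B$ a basis of a 5-dimensional $G$. $C_n$ is the $(n-1)$-dimensional matroid whose ground set consists of $n$ points summing to zero. A coset of $F$ is a set $x+\langle F\rangle$ with $x\in G\setminus F$. Doubling: $D^k(N)$ denotes the $k$-fold doubling of $N$ (the doubling of $N=(E_N,H)$ is the matroid on a geometry containing $H$ as a hyperplane with ground set $E_N\cup(a+E_N)$ for a point $a\notin H$). -}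

module Defs where

open import Data.Bool using (Bool; true; false; _xor_; _∧_; _∨_; not)
open import Data.Nat using (ℕ; zero; suc)
open import Data.Vec using (Vec; []; _∷_; zipWith; replicate; tabulate; foldr)
open import Data.List using (List; []; _∷_; _++_; map; length; filterᵇ)
open import Data.Product using (Σ; ∃; _×_; _,_)
open import Relation.Nullary using (¬_)
open import Relation.Binary.PropositionalEquality using (_≡_; _≢_; refl)
open import Function.Definitions using (Injective)

-- Points of F₂ⁿ; the projective geometry G = F₂ⁿ \ {0}.
Pt : ℕ → Set
Pt n = Vec Bool n

0v : ∀ {n} → Pt n
0v = replicate _ false

_⊕_ : ∀ {n} → Pt n → Pt n → Pt n
_⊕_ = zipWith _xor_

SubsetOf : ℕ → Set
SubsetOf n = Pt n → Bool

record Matroid (n : ℕ) : Set where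
  field
    E      : SubsetOf n
    E-no-0 : E 0v ≡ false
open Matroid public

allPts : ∀ n → List (Pt n)
allPts zero    = [] ∷ []
allPts (suc n) = map (false ∷_) (allPts n) ++ map (true ∷_) (allPts n)

∣_∣ : ∀ {n} → SubsetOf n → ℕ
∣ S ∣ = length (filterᵇ S (allPts _))

isZero : ∀ {n} → Pt n → Bool
isZero = foldr _ (λ b r → not b ∧ r) true

-- F ⊆ G is a flat iff ⟨F⟩ = F ∪ {0} is a subspace.
IsFlat : ∀ {n} → SubsetOf n → Set
IsFlat F = (F 0v ≡ false)
         × (∀ x y → (isZero x ∨ F x) ≡ true → (isZero y ∨ F y) ≡ true
                  → (isZero (x ⊕ y) ∨ F (x ⊕ y)) ≡ true)

-- Linear maps F₂ᵏ → F₂ⁿ (over F₂ additivity is linearity).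
IsLinear : ∀ {k n} → (Pt k → Pt n) → Set
IsLinear φ = ∀ x y → φ (x ⊕ y) ≡ φ x ⊕ φ y

-- M|F ≅ N, where N = (E_N, F₂ᵏ\{0}): an isomorphism of geometries
-- F₂ᵏ\{0} → F (a linear bijection F₂ᵏ → ⟨F⟩) carrying E_N onto E ∩ F.
RestrIso : ∀ {n k} → Matroid n → SubsetOf n → Matroid k → Set
RestrIso {n} {k} M F N =
  Σ (Pt k → Pt n) λ φ →
      IsLinear φ
    × Injective _≡_ _≡_ φ
    × (∀ x → x ≢ 0v → F (φ x) ≡ true)
    × (∀ y → F y ≡ true → ∃ λ x → φ x ≡ y)
    × (∀ x → x ≢ 0v → E M (φ x) ≡ E N x)

HasRestr : ∀ {n k} → Matroid n → Matroid k → Set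
HasRestr {n} M N = ∃ λ (F : SubsetOf n) → IsFlat F × RestrIso M F N

Free : ∀ {n k} → Matroid n → Matroid k → Set
Free M N = ¬ HasRestr M N

isBasisVec : ∀ {n} → Pt n → Bool
isBasisVec [] = false
isBasisVec (true ∷ v) = isZero v
isBasisVec (false ∷ v) = isBasisVec v

allOnes : ∀ {n} → Pt n → Bool
allOnes = foldr _ (λ b r → b ∧ r) true

I₅ : Matroid 5
I₅ = record { E = isBasisVec ; E-no-0 = refl }

-- C_m: (m-1)-dimensional, ground set = e₁,…,e_{m-1}, e₁+⋯+e_{m-1}
-- (m points summing to zero; unique up to isomorphism).
C₅ : Matroid 4
C₅ = record { E = λ v → isBasisVec v ∨ allOnes v ; E-no-0 = refl }

C₆ : Matroid 5
C₆ = record { E = λ v → isBasisVec v ∨ allOnes v ; E-no-0 = refl }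

Triangle : Matroid 2
Triangle = record { E = λ v → not (isZero v) ; E-no-0 = refl }

-- Triangle-free: E contains no triangle (2-dimensional flat), i.e. no
-- induced restriction isomorphic to the full rank-2 geometry.
TriangleFree : ∀ {n} → Matroid n → Set
TriangleFree M = Free M Triangle

inCoset : ∀ {n} → SubsetOf n → Pt n → SubsetOf n
inCoset F x y = isZero (y ⊕ x) ∨ F (y ⊕ x)

-- x ∈ G \ F, so x + ⟨F⟩ is a coset of F.
IsCosetRep : ∀ {n} → SubsetOf n → Pt n → Set
IsCosetRep F x = (x ≢ 0v) × (F x ≡ false)

-- Write the coset as y₀ + ⟨F⟩ with y₀ ∈ E, identify ⟨F⟩ with F₂⁵ so that E ∩ F becomes the six
-- points of C₆, and let s w say whether y₀ + w lies in E.  Triangle-freeness makes s vanish on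
-- the points of C₆.  Any four of the six points of C₆ form a basis of a hyperplane H meeting C₆
-- in exactly those four points; if s also vanished on the other nonzero points of H, then y₀ and
-- these four points would span a copy of I₅.  So each such H contains a point w ∉ C₆ ∪ {0} with
-- s w.  A finite check shows that for any two points some H contains neither of them outside
-- C₆ ∪ {0}; this yields three distinct such points, and with y₀ four points of the coset in E.
module Submission where

open import Defs
open import Data.Nat using (_≤_; zero; suc; z≤n; s≤s)
open import Data.Nat.Properties using (≤-reflexive; ≤-trans)
open import Data.Bool using (Bool; true; false; _∧_; _∨_; not; _xor_; if_then_else_; T)
import Data.Bool.Properties as B
open import Data.Bool.Properties using (T-≡; T-∧; T-not-≡; T?)
open import Data.Bool.ListAction using (all; any)
open import Data.Vec using (Vec; []; _∷_; removeAt)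
open import Data.Vec.Properties
  using (≡-dec; ∷-injectiveʳ; zipWith-assoc; zipWith-comm; zipWith-identityˡ; zipWith-identityʳ)
open import Data.List using (List; []; _∷_; _++_; map; length; concatMap; allFin)
open import Data.List.Properties using (length-++-sucʳ)
open import Data.List.Membership.Propositional using (_∈_; _∉_; find; lose)
open import Data.List.Membership.Propositional.Properties
  using (∈-map⁺; ∈-++⁺ˡ; ∈-++⁺ʳ; ∈-++⁻; ∈-∃++; ∈-filter⁺)
open import Data.List.Relation.Binary.Subset.Propositional using (_⊆_)
open import Data.List.Relation.Unary.Any using (here; there)
open import Data.List.Relation.Unary.Any.Properties using (any⁺; any⁻)
open import Data.List.Relation.Unary.All as All using (All; []; _∷_)
import Data.List.Relation.Unary.All.Properties as All
open import Data.List.Relation.Unary.AllPairs using ([]; _∷_)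
open import Data.List.Relation.Unary.Unique.Propositional using (Unique)
import Data.List.Relation.Unary.Unique.Propositional.Properties as Unique
open import Data.Product using (∃; ∃₂; _×_; _,_; proj₁; proj₂)
open import Data.Sum using (_⊎_; inj₁; inj₂)
open import Function using (_∘_; const)
open import Function.Bundles using (Equivalence)
open import Function.Definitions using (Injective)
open import Relation.Nullary using (¬_; Dec; contradiction; _×-dec_)
open import Relation.Nullary.Decidable using (⌊_⌋; toWitness; fromWitness)
open import Relation.Binary.PropositionalEquality
  using (_≡_; _≢_; refl; sym; trans; cong; cong₂; subst; module ≡-Reasoning)
open ≡-Reasoning

T⇒≡true : ∀ {b} → T b → b ≡ true
T⇒≡true = Equivalence.to T-≡

≡true⇒T : ∀ {b} → b ≡ true → T b
≡true⇒T = Equivalence.from T-≡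

≡false-≡true⇒≢ : ∀ {A : Set} (p : A → Bool) {a b} → p a ≡ false → p b ≡ true → a ≢ b
≡false-≡true⇒≢ p pa pb refl = contradiction (trans (sym pa) pb) λ ()

⊕-assoc : ∀ {n} (x y z : Pt n) → (x ⊕ y) ⊕ z ≡ x ⊕ (y ⊕ z)
⊕-assoc = zipWith-assoc B.xor-assoc

⊕-comm : ∀ {n} (x y : Pt n) → x ⊕ y ≡ y ⊕ x
⊕-comm = zipWith-comm B.xor-comm

⊕-identityˡ : ∀ {n} (x : Pt n) → 0v ⊕ x ≡ x
⊕-identityˡ = zipWith-identityˡ B.xor-identityˡ

⊕-identityʳ : ∀ {n} (x : Pt n) → x ⊕ 0v ≡ x
⊕-identityʳ = zipWith-identityʳ B.xor-identityʳ

⊕-self : ∀ {n} (x : Pt n) → x ⊕ x ≡ 0v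
⊕-self []      = refl
⊕-self (b ∷ x) = cong₂ _∷_ (B.xor-same b) (⊕-self x)

x⊕[x⊕y]≡y : ∀ {n} (x y : Pt n) → x ⊕ (x ⊕ y) ≡ y
x⊕[x⊕y]≡y x y = begin
  x ⊕ (x ⊕ y)  ≡⟨ ⊕-assoc x x y ⟨
  (x ⊕ x) ⊕ y  ≡⟨ cong (_⊕ y) (⊕-self x) ⟩
  0v ⊕ y       ≡⟨ ⊕-identityˡ y ⟩
  y            ∎

x⊕y≡0v⇒x≡y : ∀ {n} {x y : Pt n} → x ⊕ y ≡ 0v → x ≡ y
x⊕y≡0v⇒x≡y {x = x} {y} e = begin
  x            ≡⟨ ⊕-identityʳ x ⟨
  x ⊕ 0v       ≡⟨ cong (x ⊕_) e ⟨
  x ⊕ (x ⊕ y)  ≡⟨ x⊕[x⊕y]≡y x y ⟩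
  y            ∎

⊕-swapʳ : ∀ {n} (x y z : Pt n) → (x ⊕ y) ⊕ z ≡ (x ⊕ z) ⊕ y
⊕-swapʳ x y z = begin
  (x ⊕ y) ⊕ z  ≡⟨ ⊕-assoc x y z ⟩
  x ⊕ (y ⊕ z)  ≡⟨ cong (x ⊕_) (⊕-comm y z) ⟩
  x ⊕ (z ⊕ y)  ≡⟨ ⊕-assoc x z y ⟨
  (x ⊕ z) ⊕ y  ∎

⊕-interchange : ∀ {n} (w x y z : Pt n) → (w ⊕ x) ⊕ (y ⊕ z) ≡ (w ⊕ y) ⊕ (x ⊕ z)
⊕-interchange w x y z = begin
  (w ⊕ x) ⊕ (y ⊕ z)  ≡⟨ ⊕-assoc (w ⊕ x) y z ⟨
  ((w ⊕ x) ⊕ y) ⊕ z  ≡⟨ cong (_⊕ z) (⊕-swapʳ w x y) ⟩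
  ((w ⊕ y) ⊕ x) ⊕ z  ≡⟨ ⊕-assoc (w ⊕ y) x z ⟩
  (w ⊕ y) ⊕ (x ⊕ z)  ∎

isZero-0v : ∀ {n} → isZero (0v {n}) ≡ true
isZero-0v {zero}  = refl
isZero-0v {suc n} = isZero-0v {n}

isZero⇒≡0v : ∀ {n} (x : Pt n) → isZero x ≡ true → x ≡ 0v
isZero⇒≡0v []          _ = refl
isZero⇒≡0v (false ∷ x) h = cong (false ∷_) (isZero⇒≡0v x h)
isZero⇒≡0v (true ∷ x)  ()

isZero-≢0v : ∀ {n} (x : Pt n) → x ≢ 0v → isZero x ≡ false
isZero-≢0v x x≢0 = B.¬-not (x≢0 ∘ isZero⇒≡0v x)

_≟ᵥ_ : ∀ {n} (x y : Pt n) → Dec (x ≡ y)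
_≟ᵥ_ = ≡-dec B._≟_

infixr 25 _·_

_·_ : ∀ {n} → Bool → Pt n → Pt n
b · y = if b then y else 0v

·-distribʳ-xor : ∀ {n} a b (y : Pt n) → (a xor b) · y ≡ a · y ⊕ b · y
·-distribʳ-xor true  true  y = sym (⊕-self y)
·-distribʳ-xor true  false y = sym (⊕-identityʳ y)
·-distribʳ-xor false b     y = sym (⊕-identityˡ (b · y))

∘-linear : ∀ {k m n} {ψ : Pt m → Pt n} {θ : Pt k → Pt m} → IsLinear ψ → IsLinear θ → IsLinear (ψ ∘ θ)
∘-linear {ψ = ψ} ψ-linear θ-linear a b = trans (cong ψ (θ-linear a b)) (ψ-linear _ _)

linear-0 : ∀ {k n} {ψ : Pt k → Pt n} → IsLinear ψ → ψ 0v ≡ 0v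
linear-0 {ψ = ψ} ψ-linear = begin
  ψ 0v          ≡⟨ cong ψ (⊕-self 0v) ⟨
  ψ (0v ⊕ 0v)   ≡⟨ ψ-linear 0v 0v ⟩
  ψ 0v ⊕ ψ 0v   ≡⟨ ⊕-self (ψ 0v) ⟩
  0v            ∎

injective⇒trivialKernel : ∀ {k n} {ψ : Pt k → Pt n} → IsLinear ψ → Injective _≡_ _≡_ ψ
  → ∀ z → ψ z ≡ 0v → z ≡ 0v
injective⇒trivialKernel ψ-linear ψ-injective z e = ψ-injective (trans e (sym (linear-0 ψ-linear)))

trivialKernel⇒injective : ∀ {k n} {ψ : Pt k → Pt n} → IsLinear ψ → (∀ z → ψ z ≡ 0v → z ≡ 0v)
  → Injective _≡_ _≡_ ψ
trivialKernel⇒injective {ψ = ψ} ψ-linear kernel {a} {b} e =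
  x⊕y≡0v⇒x≡y (kernel (a ⊕ b) (trans (ψ-linear a b) (trans (cong (_⊕ ψ b) e) (⊕-self (ψ b)))))

extend : ∀ {k n} → Pt n → (Pt k → Pt n) → Pt (suc k) → Pt n
extend y ψ (b ∷ v) = b · y ⊕ ψ v

extend-linear : ∀ {k n} {y : Pt n} {ψ : Pt k → Pt n} → IsLinear ψ → IsLinear (extend y ψ)
extend-linear {y = y} {ψ} ψ-linear (a ∷ u) (b ∷ v) = begin
  (a xor b) · y ⊕ ψ (u ⊕ v)      ≡⟨ cong₂ _⊕_ (·-distribʳ-xor a b y) (ψ-linear u v) ⟩
  (a · y ⊕ b · y) ⊕ (ψ u ⊕ ψ v)  ≡⟨ ⊕-interchange (a · y) (b · y) (ψ u) (ψ v) ⟩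
  (a · y ⊕ ψ u) ⊕ (b · y ⊕ ψ v)  ∎

extend-injective : ∀ {k n} {y : Pt n} {ψ : Pt k → Pt n} → IsLinear ψ → Injective _≡_ _≡_ ψ
  → (∀ v → ψ v ≢ y) → Injective _≡_ _≡_ (extend y ψ)
extend-injective {y = y} {ψ} ψ-linear ψ-injective y∉ψ =
  trivialKernel⇒injective (extend-linear ψ-linear) kernel
  where
  kernel : ∀ u → extend y ψ u ≡ 0v → u ≡ 0v
  kernel (false ∷ v) e =
    cong (false ∷_) (injective⇒trivialKernel ψ-linear ψ-injective v (trans (sym (⊕-identityˡ (ψ v))) e))
  kernel (true ∷ v) e = contradiction (sym (x⊕y≡0v⇒x≡y e)) (y∉ψ v)

lin : ∀ {k n} → Vec (Pt n) k → Pt k → Pt n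
lin []       = const 0v
lin (c ∷ cs) = extend c (lin cs)

lin-linear : ∀ {k n} (cs : Vec (Pt n) k) → IsLinear (lin cs)
lin-linear []       _ _ = sym (⊕-self 0v)
lin-linear (c ∷ cs)     = extend-linear (lin-linear cs)

lin-[_] : ∀ {n} (c : Pt n) b → lin (c ∷ []) (b ∷ []) ≡ b · c
lin-[ c ] b = ⊕-identityʳ (b · c)

∈-allPts : ∀ {n} (x : Pt n) → x ∈ allPts n
∈-allPts []                = here refl
∈-allPts {suc n} (false ∷ x) = ∈-++⁺ˡ (∈-map⁺ (false ∷_) (∈-allPts x))
∈-allPts {suc n} (true ∷ x)  = ∈-++⁺ʳ (map (false ∷_) (allPts n)) (∈-map⁺ (true ∷_) (∈-allPts x))

all-allPts : ∀ {n} (p : Pt n → Bool) → T (all p (allPts n)) → ∀ x → T (p x)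
all-allPts p h x = All.lookup (All.all⁺ p _ h) (∈-allPts x)

all²-allPts : ∀ {m n} (p : Pt m → Pt n → Bool) → T (all (λ x → all (p x) (allPts n)) (allPts m))
  → ∀ x y → T (p x y)
all²-allPts {n = n} p h x = all-allPts (p x) (all-allPts (λ x → all (p x) (allPts n)) h x)

find-allPts : ∀ {n} (p : Pt n → Bool) → (∃ λ x → p x ≡ true) ⊎ (∀ x → p x ≡ false)
find-allPts {n} p with any p (allPts n) in found
... | true  = let x , _ , px = find (any⁻ p (allPts n) (≡true⇒T found)) in inj₁ (x , T⇒≡true px)
... | false = inj₂ λ x → B.¬-not λ px →
  contradiction (trans (sym found) (T⇒≡true (any⁺ p (lose (∈-allPts x) (≡true⇒T px))))) λ ()

inRange : ∀ {k n} → (Pt k → Pt n) → SubsetOf n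
inRange {k} ψ y = any (λ z → ⌊ ψ z ≟ᵥ y ⌋) (allPts k)

inRange-hit : ∀ {k n} (ψ : Pt k → Pt n) z → inRange ψ (ψ z) ≡ true
inRange-hit ψ z = T⇒≡true (any⁺ (λ z′ → ⌊ ψ z′ ≟ᵥ ψ z ⌋) (lose (∈-allPts z) (fromWitness refl)))

inRange⇒preimage : ∀ {k n} (ψ : Pt k → Pt n) {y} → inRange ψ y ≡ true → ∃ λ z → ψ z ≡ y
inRange⇒preimage {k} ψ {y} h
  with z , _ , ψz≡y ← find (any⁻ (λ z → ⌊ ψ z ≟ᵥ y ⌋) (allPts k) (≡true⇒T h)) = z , toWitness ψz≡y

remove-⊆ : ∀ {A : Set} {x : A} {xs} ys₁ {ys₂} → xs ⊆ ys₁ ++ x ∷ ys₂ → x ∉ xs → xs ⊆ ys₁ ++ ys₂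
remove-⊆ ys₁ xs⊆ x∉xs v∈xs with ∈-++⁻ ys₁ (xs⊆ v∈xs)
... | inj₁ v∈ys₁         = ∈-++⁺ˡ v∈ys₁
... | inj₂ (here refl)   = contradiction v∈xs x∉xs
... | inj₂ (there v∈ys₂) = ∈-++⁺ʳ ys₁ v∈ys₂

Unique-⊆⇒length≤ : ∀ {A : Set} {xs ys : List A} → Unique xs → xs ⊆ ys → length xs ≤ length ys
Unique-⊆⇒length≤ {xs = []} _ _ = z≤n
Unique-⊆⇒length≤ {xs = x ∷ xs} x∷xs!@(_ ∷ xs!) x∷xs⊆ys
  with ys₁ , ys₂ , refl ← ∈-∃++ (x∷xs⊆ys (here refl)) =
  ≤-trans (s≤s (Unique-⊆⇒length≤ xs! xs⊆ys₁++ys₂)) (≤-reflexive (sym (length-++-sucʳ ys₁ x ys₂)))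
  where
  xs⊆ys₁++ys₂ : xs ⊆ ys₁ ++ ys₂
  xs⊆ys₁++ys₂ = remove-⊆ ys₁ (x∷xs⊆ys ∘ there) (Unique.Unique[x∷xs]⇒x∉xs x∷xs!)

Unique⇒length≤∣∣ : ∀ {n} {P : SubsetOf n} {ds} → Unique ds → All (T ∘ P) ds → length ds ≤ ∣ P ∣
Unique⇒length≤∣∣ {P = P} ds! P-ds =
  Unique-⊆⇒length≤ ds! (λ d∈ds → ∈-filter⁺ (T? ∘ P) (∈-allPts _) (All.lookup P-ds d∈ds))

_∈⟨_⟩ : ∀ {n} → Pt n → SubsetOf n → Set
z ∈⟨ F ⟩ = (isZero z ∨ F z) ≡ true

∈⇒∈⟨⟩ : ∀ {n} {F : SubsetOf n} {z} → F z ≡ true → z ∈⟨ F ⟩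
∈⇒∈⟨⟩ {z = z} Fz rewrite Fz = B.∨-zeroʳ (isZero z)

cosetRep-∉⟨⟩ : ∀ {n} {F : SubsetOf n} {x y} → IsFlat F → IsCosetRep F x → (y ⊕ x) ∈⟨ F ⟩ → ¬ y ∈⟨ F ⟩
cosetRep-∉⟨⟩ {F = F} {x} {y} (_ , closed) (x≢0 , Fx≡false) y⊕x∈ y∈ =
  x≢0 (isZero⇒≡0v x (trans (sym (B.∨-identityʳ (isZero x)))
                            (subst (λ b → (isZero x ∨ b) ≡ true) Fx≡false x∈)))
  where
  x∈ : x ∈⟨ F ⟩
  x∈ = subst (_∈⟨ F ⟩) (x⊕[x⊕y]≡y y x) (closed y (y ⊕ x) y∈ y⊕x∈)

coset-translate : ∀ {n} {F : SubsetOf n} {x y z} → IsFlat F → (y ⊕ x) ∈⟨ F ⟩ → z ∈⟨ F ⟩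
  → inCoset F x (y ⊕ z) ≡ true
coset-translate {F = F} {x} {y} {z} (_ , closed) y⊕x∈ z∈ =
  subst (_∈⟨ F ⟩) (⊕-swapʳ y x z) (closed (y ⊕ x) z y⊕x∈ z∈)

image : ∀ {k n} → (Pt k → Pt n) → SubsetOf n
image ψ y = not (isZero y) ∧ inRange ψ y

∈⟨image⟩ : ∀ {k n} (ψ : Pt k → Pt n) z → ψ z ∈⟨ image ψ ⟩
∈⟨image⟩ ψ z with isZero (ψ z)
... | true  = refl
... | false = inRange-hit ψ z

∈⟨image⟩⇒preimage : ∀ {k n} {ψ : Pt k → Pt n} → IsLinear ψ → ∀ y → y ∈⟨ image ψ ⟩ → ∃ λ z → ψ z ≡ y
∈⟨image⟩⇒preimage {ψ = ψ} ψ-linear y h with isZero y in y≡0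
... | true  = 0v , trans (linear-0 ψ-linear) (sym (isZero⇒≡0v y y≡0))
... | false = inRange⇒preimage ψ h

image-flat : ∀ {k n} {ψ : Pt k → Pt n} → IsLinear ψ → IsFlat (image ψ)
image-flat {n = n} {ψ} ψ-linear = cong (λ b → not b ∧ inRange ψ 0v) (isZero-0v {n}) , closed
  where
  closed : ∀ a b → a ∈⟨ image ψ ⟩ → b ∈⟨ image ψ ⟩ → (a ⊕ b) ∈⟨ image ψ ⟩
  closed a b a∈ b∈
    with za , refl ← ∈⟨image⟩⇒preimage ψ-linear a a∈
       | zb , refl ← ∈⟨image⟩⇒preimage ψ-linear b b∈ =
    subst (_∈⟨ image ψ ⟩) (ψ-linear za zb) (∈⟨image⟩ ψ (za ⊕ zb))

embedding⇒HasRestr : ∀ {k n} (M : Matroid n) (N : Matroid k) (ψ : Pt k → Pt n)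
  → IsLinear ψ → Injective _≡_ _≡_ ψ → (∀ z → z ≢ 0v → E M (ψ z) ≡ E N z) → HasRestr M N
embedding⇒HasRestr M N ψ ψ-linear ψ-injective ψ-E =
  image ψ , image-flat ψ-linear , ψ , ψ-linear , ψ-injective , image-hit , onto , ψ-E
  where
  image-hit : ∀ z → z ≢ 0v → image ψ (ψ z) ≡ true
  image-hit z z≢0
    rewrite isZero-≢0v (ψ z) (z≢0 ∘ injective⇒trivialKernel ψ-linear ψ-injective z) = inRange-hit ψ z
  onto : ∀ y → image ψ y ≡ true → ∃ λ z → ψ z ≡ y
  onto y h = inRange⇒preimage ψ (B.∧-conicalʳ _ _ h)

-- Hyperplanes of C₆ spanned by four of its points

c₆Points : Vec (Pt 5) 6
c₆Points = (true  ∷ false ∷ false ∷ false ∷ false ∷ [])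
         ∷ (false ∷ true  ∷ false ∷ false ∷ false ∷ [])
         ∷ (false ∷ false ∷ true  ∷ false ∷ false ∷ [])
         ∷ (false ∷ false ∷ false ∷ true  ∷ false ∷ [])
         ∷ (false ∷ false ∷ false ∷ false ∷ true  ∷ [])
         ∷ (true  ∷ true  ∷ true  ∷ true  ∷ true  ∷ [])
         ∷ []

Frame : Set
Frame = Vec (Pt 5) 4

-- All ways of dropping two of the six points, so each of the fifteen hyperplanes occurs twice.
frames : List Frame
frames = concatMap (λ i → map (removeAt (removeAt c₆Points i)) (allFin 5)) (allFin 6)

C₆FrameAt : Frame → Pt 4 → Set
C₆FrameAt f z = isZero (lin f z) ≡ isZero z × E C₆ (lin f z) ≡ isBasisVec z

C₆FrameAt? : ∀ f z → Dec (C₆FrameAt f z)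
C₆FrameAt? f z = (isZero (lin f z) B.≟ isZero z) ×-dec (E C₆ (lin f z) B.≟ isBasisVec z)

isC₆Frame : Frame → Bool
isC₆Frame f = all (λ z → ⌊ C₆FrameAt? f z ⌋) (allPts 4)

frames-C₆ : T (all isC₆Frame frames)
frames-C₆ = _

frame-C₆At : ∀ {f} → f ∈ frames → ∀ z → C₆FrameAt f z
frame-C₆At {f} f∈ z = toWitness {a? = C₆FrameAt? f z}
  (all-allPts (λ z → ⌊ C₆FrameAt? f z ⌋) (All.lookup (All.all⁺ isC₆Frame frames frames-C₆) f∈) z)

frame-injective : ∀ {f} → f ∈ frames → Injective _≡_ _≡_ (lin f)
frame-injective {f} f∈ = trivialKernel⇒injective (lin-linear f) kernel
  where
  kernel : ∀ z → lin f z ≡ 0v → z ≡ 0v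
  kernel z e = isZero⇒≡0v z (begin
    isZero z         ≡⟨ proj₁ (frame-C₆At f∈ z) ⟨
    isZero (lin f z) ≡⟨ cong isZero e ⟩
    isZero (0v {5})  ≡⟨ isZero-0v {5} ⟩
    true             ∎)

inSpanOffC₆ : Frame → Pt 5 → Bool
inSpanOffC₆ f w = not (isZero w) ∧ not (E C₆ w) ∧ inRange (lin f) w

inSpanOffC₆-lin : ∀ {f} → f ∈ frames → ∀ {z} → z ≢ 0v → E C₆ (lin f z) ≡ false
  → inSpanOffC₆ f (lin f z) ≡ true
inSpanOffC₆-lin {f} f∈ {z} z≢0 fz∉C₆ =
  trans (cong₂ (λ a b → not a ∧ not b ∧ inRange (lin f) (lin f z)) fz≢0 fz∉C₆) (inRange-hit (lin f) z)
  where
  fz≢0 : isZero (lin f z) ≡ false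
  fz≢0 = isZero-≢0v (lin f z) (z≢0 ∘ injective⇒trivialKernel (lin-linear f) (frame-injective f∈) z)

inSpanOffC₆⇒0v≢ : ∀ f {w} → inSpanOffC₆ f w ≡ true → 0v ≢ w
inSpanOffC₆⇒0v≢ _ h refl = contradiction h λ ()

avoids : Pt 5 → Pt 5 → Frame → Bool
avoids w₁ w₂ f = not (inSpanOffC₆ f w₁) ∧ not (inSpanOffC₆ f w₂)

frames-cover : ∀ w₁ w₂ → T (any (avoids w₁ w₂) frames)
frames-cover = all²-allPts (λ w₁ w₂ → any (avoids w₁ w₂) frames) _

avoiding-frame : ∀ w₁ w₂ → ∃ λ f → f ∈ frames × inSpanOffC₆ f w₁ ≡ false × inSpanOffC₆ f w₂ ≡ false
avoiding-frame w₁ w₂ =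
  let f , f∈ , f-avoids = find (any⁻ (avoids w₁ w₂) frames (frames-cover w₁ w₂))
      f∌w₁ , f∌w₂ = Equivalence.to T-∧ f-avoids
  in f , f∈ , Equivalence.to T-not-≡ f∌w₁ , Equivalence.to T-not-≡ f∌w₂

-- A coset of a C₆-flat

module C₆Coset {n} (M : Matroid n) {F : SubsetOf n} (F-flat : IsFlat F)
  {φ : Pt 5 → Pt n} (φ-linear : IsLinear φ) (φ-injective : Injective _≡_ _≡_ φ)
  (φ-F : ∀ v → v ≢ 0v → F (φ v) ≡ true) (φ-E : ∀ v → v ≢ 0v → E M (φ v) ≡ E C₆ v)
  {x : Pt n} (x-rep : IsCosetRep F x)
  {y₀ : Pt n} (y₀-coset : inCoset F x y₀ ≡ true) (y₀-E : E M y₀ ≡ true)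
  where

  φ-∈⟨F⟩ : ∀ v → φ v ∈⟨ F ⟩
  φ-∈⟨F⟩ v with isZero v in v≡0
  ... | true  = subst (_∈⟨ F ⟩) (sym (trans (cong φ (isZero⇒≡0v v v≡0)) (linear-0 φ-linear)))
                      (cong (_∨ F 0v) (isZero-0v {n}))
  ... | false = ∈⇒∈⟨⟩ {F = F} (φ-F v λ { refl → contradiction (trans (sym (isZero-0v {5})) v≡0) λ () })

  y₀∉φ : ∀ v → φ v ≢ y₀
  y₀∉φ v e = cosetRep-∉⟨⟩ F-flat x-rep y₀-coset (subst (_∈⟨ F ⟩) e (φ-∈⟨F⟩ v))

  q : Pt 5 → Pt n
  q w = y₀ ⊕ φ w

  q-injective : Injective _≡_ _≡_ q
  q-injective e = ∷-injectiveʳ (extend-injective φ-linear φ-injective y₀∉φ {true ∷ _} {true ∷ _} e)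

  s : Pt 5 → Bool
  s w = E M (q w)

  q-∈ : ∀ {w} → s w ≡ true → T (inCoset F x (q w) ∧ E M (q w))
  q-∈ {w} sw = ≡true⇒T (cong₂ _∧_ (coset-translate F-flat y₀-coset (φ-∈⟨F⟩ w)) sw)

  s-0v : s 0v ≡ true
  s-0v = trans (cong (E M) (trans (cong (y₀ ⊕_) (linear-0 φ-linear)) (⊕-identityʳ y₀))) y₀-E

  restriction : ∀ {k} (N : Matroid (suc k)) (θ : Pt k → Pt 5) → IsLinear θ → Injective _≡_ _≡_ θ
    → (∀ z → z ≢ 0v → E C₆ (θ z) ≡ E N (false ∷ z)) → (∀ z → s (θ z) ≡ E N (true ∷ z))
    → HasRestr M N
  restriction N θ θ-linear θ-injective on-F on-coset =
    embedding⇒HasRestr M N (extend y₀ (φ ∘ θ)) (extend-linear φθ-linear) ψ-injective ψ-E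
    where
    φθ-linear : IsLinear (φ ∘ θ)
    φθ-linear = ∘-linear φ-linear θ-linear
    ψ-injective : Injective _≡_ _≡_ (extend y₀ (φ ∘ θ))
    ψ-injective = extend-injective φθ-linear (θ-injective ∘ φ-injective) (y₀∉φ ∘ θ)
    ψ-E : ∀ u → u ≢ 0v → E M (extend y₀ (φ ∘ θ) u) ≡ E N u
    ψ-E (true ∷ z)  _   = on-coset z
    ψ-E (false ∷ z) u≢0 = begin
      E M (0v ⊕ φ (θ z)) ≡⟨ cong (E M) (⊕-identityˡ (φ (θ z))) ⟩
      E M (φ (θ z))      ≡⟨ φ-E (θ z) (z≢0 ∘ injective⇒trivialKernel θ-linear θ-injective z) ⟩
      E C₆ (θ z)         ≡⟨ on-F z z≢0 ⟩
      E N (false ∷ z)    ∎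
      where
      z≢0 : z ≢ 0v
      z≢0 refl = u≢0 refl

  s-vanishes-on-C₆ : TriangleFree M → ∀ c → E C₆ c ≡ true → s c ≡ false
  s-vanishes-on-C₆ Δ-free c c∈C₆ = B.¬-not λ sc →
    Δ-free (restriction Triangle (lin (c ∷ [])) (lin-linear (c ∷ [])) θ-injective on-F (on-coset sc))
    where
    θ-injective : Injective _≡_ _≡_ (lin (c ∷ []))
    θ-injective = trivialKernel⇒injective (lin-linear (c ∷ [])) kernel
      where
      kernel : ∀ z → lin (c ∷ []) z ≡ 0v → z ≡ 0v
      kernel (false ∷ []) _ = refl
      kernel (true ∷ [])  e =
        contradiction (subst (λ v → E C₆ v ≡ true) (trans (sym (lin-[ c ] true)) e) c∈C₆) λ ()
    on-F : ∀ z → z ≢ 0v → E C₆ (lin (c ∷ []) z) ≡ E Triangle (false ∷ z)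
    on-F (false ∷ []) z≢0 = contradiction refl z≢0
    on-F (true ∷ [])  _   = trans (cong (E C₆) (lin-[ c ] true)) c∈C₆
    on-coset : s c ≡ true → ∀ z → s (lin (c ∷ []) z) ≡ E Triangle (true ∷ z)
    on-coset _  (false ∷ []) = trans (cong s (lin-[ c ] false)) s-0v
    on-coset sc (true ∷ [])  = trans (cong s (lin-[ c ] true)) sc

  frame-meets-s : Free M I₅ → TriangleFree M → ∀ {f} → f ∈ frames
    → ∃ λ w → inSpanOffC₆ f w ≡ true × s w ≡ true
  frame-meets-s I₅-free Δ-free {f} f∈ with find-allPts (λ w → inSpanOffC₆ f w ∧ s w)
  ... | inj₁ (w , h) = w , B.∧-conicalˡ _ _ h , B.∧-conicalʳ _ _ h
  ... | inj₂ none    =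
    contradiction (restriction I₅ (lin f) (lin-linear f) (frame-injective f∈) on-F on-coset) I₅-free
    where
    on-F : ∀ z → z ≢ 0v → E C₆ (lin f z) ≡ isBasisVec z
    on-F z _ = proj₂ (frame-C₆At f∈ z)
    s-off-found : ∀ w → inSpanOffC₆ f w ≡ true → s w ≡ false
    s-off-found w w∈ = subst (λ b → b ∧ s w ≡ false) w∈ (none w)
    on-coset : ∀ z → s (lin f z) ≡ isZero z
    on-coset z with isZero z in z≡0 | E C₆ (lin f z) in C₆[fz]
    ... | true  | _     =
      trans (cong s (trans (cong (lin f) (isZero⇒≡0v z z≡0)) (linear-0 (lin-linear f)))) s-0v
    ... | false | true  = s-vanishes-on-C₆ Δ-free (lin f z) C₆[fz]
    ... | false | false = s-off-found (lin f z) (inSpanOffC₆-lin f∈ z≢0 C₆[fz])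
      where
      z≢0 : z ≢ 0v
      z≢0 refl = contradiction (trans (sym (isZero-0v {4})) z≡0) λ ()

  -- Abstract, so that the type checker never unfolds the witness searches at concrete points.
  abstract
    new-point : Free M I₅ → TriangleFree M → ∀ w w′ → ∃ λ w″ → 0v ≢ w″ × w ≢ w″ × w′ ≢ w″ × s w″ ≡ true
    new-point I₅-free Δ-free w w′ =
      let f , f∈ , f∌w , f∌w′ = avoiding-frame w w′
          w″ , f∋w″ , s-w″    = frame-meets-s I₅-free Δ-free {f} f∈
      in w″ , inSpanOffC₆⇒0v≢ f f∋w″ , ≡false-≡true⇒≢ (inSpanOffC₆ f) f∌w f∋w″
       , ≡false-≡true⇒≢ (inSpanOffC₆ f) f∌w′ f∋w″ , s-w″

  four-points : Free M I₅ → TriangleFree M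
    → ∃₂ λ w₁ w₂ → ∃ λ w₃ → Unique (0v ∷ w₁ ∷ w₂ ∷ w₃ ∷ []) × All (λ w → s w ≡ true) (0v ∷ w₁ ∷ w₂ ∷ w₃ ∷ [])
  four-points I₅-free Δ-free =
    let w₁ , 0≢w₁ , _     , _     , s₁ = new-point I₅-free Δ-free 0v 0v
        w₂ , 0≢w₂ , w₁≢w₂ , _     , s₂ = new-point I₅-free Δ-free w₁ w₁
        w₃ , 0≢w₃ , w₁≢w₃ , w₂≢w₃ , s₃ = new-point I₅-free Δ-free w₁ w₂
    in w₁ , w₂ , w₃
     , ((0≢w₁ ∷ 0≢w₂ ∷ 0≢w₃ ∷ []) ∷ (w₁≢w₂ ∷ w₁≢w₃ ∷ []) ∷ (w₂≢w₃ ∷ []) ∷ [] ∷ [])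
     , s-0v ∷ s₁ ∷ s₂ ∷ s₃ ∷ []

  coset-count : Free M I₅ → TriangleFree M → 4 ≤ ∣ (λ y → inCoset F x y ∧ E M y) ∣
  coset-count I₅-free Δ-free with _ , _ , _ , ws-unique , s-ws ← four-points I₅-free Δ-free =
    Unique⇒length≤∣∣ (Unique.map⁺ q-injective ws-unique) (All.map⁺ (All.map q-∈ s-ws))

lemma4p3 : ∀ {n} (M : Matroid n) → Free M I₅ → Free M C₅ → TriangleFree M
    → (F : SubsetOf n) → IsFlat F → RestrIso M F C₆
    → (x : Pt n) → IsCosetRep F x
    → (∃ λ y → (inCoset F x y ∧ E M y) ≡ true)
    → 4 ≤ ∣ (λ y → inCoset F x y ∧ E M y) ∣
lemma4p3 M I₅-free _ Δ-free F F-flat (_ , φ-linear , φ-injective , φ-F , _ , φ-E) x x-rep (y₀ , y₀∈) =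
  C₆Coset.coset-count M F-flat φ-linear φ-injective φ-F φ-E x-rep
    (B.∧-conicalˡ _ _ y₀∈) (B.∧-conicalʳ _ _ y₀∈) I₅-free Δ-free
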